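{- Suppose there exist symmetric $2$-$(n,k_i,\lambda_i)$ designs ($i=1,2$) whose incidence matrices $N_1,N_2$ satisfy $N_1N_2^T+N_2N_1^T=\mu_1I_n+\mu_2(J_n-I_n)$. Then for every integer $m\ge2$ there exists a global decomposable STD$(n)$ self-dual rectangular design with parameters $v=b=mn$, $r=k=k_1+(m-1)k_2$, $\lambda_1'=\lambda_1+(m-1)\lambda_2$, $\lambda_2'=(m-2)k_2+\mu_1$, $\lambda_3'=(m-2)\lambda_2+\mu_2$, $m$, $n$ (here $\lambda_1',\lambda_2',\lambda_3'$ are the row, column and other concurrences respectively).
   Context: A symmetric $2$-$(n,k,\lambda)$ design has $n$ treatments, $n$ blocks of size $k$, and any two distinct treatments occur together in $\lambda$ blocks. A rectangular design (RD) on $v=mn$ treatments arranged in an $m\times n$ array has $b$ blocks of size $k$, replication $r$, and any two distinct treatments occur together in $\lambda_1$ blocks if in the same row, $\lambda_2$ if in the same column, $\lambda_3$ otherwise. It is self-dual (SDRD) if the design with the transposed incidence matrix is an RD with the same parameters. It is STD$(n)$ if its incidence matrix (rows grouped by rows of the array) is partitioned into $n\times n$ submatrices each having constant row sums and constant column sums. An SDRD with incidence matrix $N=[N_{ij}]_{i,j=1,\dots,m}$ ($n\times n$ blocks) is global decomposable if each $N_{ij}$ is the incidence matrix of a symmetric design and, with $R_i=(N_{i1}|\cdots|N_{im})$, $R_iR_i^T=kI_n+\lambda_1(J_n-I_n)$ and $R_iR_j^T=\lambda_2I_n+\lambda_3(J_n-I_n)$ for $i\ne j$. -}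

module Defs where

open import Data.Nat using (ℕ; zero; suc; _+_; _*_)
open import Data.Fin using (Fin; zero; suc; _≟_)
open import Data.Product using (_×_; _,_; ∃)
open import Data.Sum using (_⊎_)
open import Data.Bool using (if_then_else_)
open import Relation.Nullary using (¬_)
open import Relation.Nullary.Decidable using (⌊_⌋)
open import Relation.Binary.PropositionalEquality using (_≡_; _≢_)

sumF : ∀ {n} → (Fin n → ℕ) → ℕ
sumF {zero}  f = 0
sumF {suc n} f = f zero + sumF (λ i → f (suc i))

Mat : ℕ → Set
Mat n = Fin n → Fin n → ℕ

-- Entry (a,a') of  d I_n + o (J_n - I_n).
IJ : ∀ {n} → ℕ → ℕ → Fin n → Fin n → ℕ
IJ d o a a' = if ⌊ a ≟ a' ⌋ then d else o

Binary : ∀ {A B : Set} → (A → B → ℕ) → Set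
Binary {A} {B} N = ∀ (x : A) (y : B) → N x y ≡ 0 ⊎ N x y ≡ 1

-- Symmetric 2-(n,k,λ) design with incidence matrix N
-- (rows = treatments, columns = blocks): n blocks, each of size k,
-- any two distinct treatments together in exactly λ blocks.
IsSymDesign : (n k l : ℕ) → Mat n → Set
IsSymDesign n k l N =
  Binary N
  × (∀ c → sumF (λ a → N a c) ≡ k)
  × (∀ a a' → a ≢ a' → sumF (λ c → N a c * N a' c) ≡ l)

-- Rectangular designs on v = mn treatments, arranged in an m × n array.
-- Treatment (i , a) lies in row i ∈ Fin m and column a ∈ Fin n.
-- Here b = mn as well; blocks are labelled by Fin m × Fin n, the first
-- component giving the block-group (column-block index of N = [N_ij]).

Idx : ℕ → ℕ → Set
Idx m n = Fin m × Fin n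

sum2 : ∀ {m n} → (Idx m n → ℕ) → ℕ
sum2 f = sumF (λ i → sumF (λ a → f (i , a)))

MatR : ℕ → ℕ → Set
MatR m n = Idx m n → Idx m n → ℕ

transposeR : ∀ {m n} → MatR m n → MatR m n
transposeR N x y = N y x

conc : ∀ {m n} → MatR m n → Idx m n → Idx m n → ℕ
conc N x x' = sum2 (λ y → N x y * N x' y)

IsRD : (m n k r l₁ l₂ l₃ : ℕ) → MatR m n → Set
IsRD m n k r l₁ l₂ l₃ N =
  Binary N
  × (∀ y → sum2 (λ x → N x y) ≡ k)
  × (∀ x → sum2 (λ y → N x y) ≡ r)
  × (∀ (i : Fin m) (a a' : Fin n) → a ≢ a' → conc N (i , a) (i , a') ≡ l₁)
  × (∀ (i i' : Fin m) (a : Fin n) → i ≢ i' → conc N (i , a) (i' , a) ≡ l₂)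
  × (∀ (i i' : Fin m) (a a' : Fin n) → i ≢ i' → a ≢ a' →
       conc N (i , a) (i' , a') ≡ l₃)

IsSDRD : (m n k r l₁ l₂ l₃ : ℕ) → MatR m n → Set
IsSDRD m n k r l₁ l₂ l₃ N =
  IsRD m n k r l₁ l₂ l₃ N × IsRD m n k r l₁ l₂ l₃ (transposeR N)

sub : ∀ {m n} → MatR m n → Fin m → Fin m → Mat n
sub N i j a c = N (i , a) (j , c)

IsSTD : ∀ {m n} → MatR m n → Set
IsSTD {m} {n} N =
  ∀ (i j : Fin m) →
    (∃ λ s → ∀ a → sumF (λ c → sub N i j a c) ≡ s)
    × (∃ λ t → ∀ c → sumF (λ a → sub N i j a c) ≡ t)

-- Global decomposability of an SDRD with parameters k, l₁, l₂, l₃.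
-- (R_i R_j^T)(a,a') = conc N (i , a) (j , a').
IsGlobalDecomposable : (m n k l₁ l₂ l₃ : ℕ) → MatR m n → Set
IsGlobalDecomposable m n k l₁ l₂ l₃ N =
  (∀ (i j : Fin m) → ∃ λ k' → ∃ λ l' → IsSymDesign n k' l' (sub N i j))
  × (∀ (i : Fin m) (a a' : Fin n) → conc N (i , a) (i , a') ≡ IJ k l₁ a a')
  × (∀ (i j : Fin m) → i ≢ j → ∀ (a a' : Fin n) →
       conc N (i , a) (j , a') ≡ IJ l₂ l₃ a a')

module Submission where

-- First replace N₁, N₂ by matrices A, B with the same parameters whose rows
-- also sum to k₁, k₂.  Counting pairs in a row gives r (k − 1) = (n − 1) λ, so
-- this is automatic for k ≠ 1; for k = 1 (a single 1 per column, rows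
-- arbitrary) either the cross condition forces the row sums or permutation
-- matrices with the same parameters are substituted.  The block matrix with A
-- on the diagonal and B elsewhere has R_i R_jᵀ equal to AAᵀ + (m − 1) BBᵀ or
-- ABᵀ + BAᵀ + (m − 2) BBᵀ, which gives the rectangular parameters.  Its
-- transpose is the same construction on Aᵀ, Bᵀ, so self-duality needs
-- AᵀA = AAᵀ, BᵀB = BBᵀ and AᵀB + BᵀA = ABᵀ + BAᵀ.  A natural matrix T equals
-- Q = xI + y(J − I) as soon as T and Q have the same trace, entry sum and
-- Σ T², since then Σ (T − Q)² = 0; for the matrices above these three moments
-- agree by cyclicity of the trace.

open import Defs
open import Data.Nat as ℕ using (ℕ; zero; suc; _+_; _*_; _∸_; _≤_; s≤s; NonZero; ∣_-_∣)
open import Data.Nat.Properties hiding (_≟_)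
open import Data.Nat.Tactic.RingSolver using (solve-∀)
open import Data.Fin using (Fin; zero; suc; _≟_; punchIn; punchOut)
open import Data.Fin.Patterns using (0F; 1F; 2F)
open import Data.Fin.Properties using (punchInᵢ≢i; punchIn-punchOut; punchIn-injective; all?; nonZeroIndex)
open import Data.Vec.Functional using (removeAt)
open import Data.Product using (_×_; _,_; ∃; Σ)
open import Data.Sum using (_⊎_; inj₁; inj₂; reduce)
open import Data.Bool using (if_then_else_)
open import Function using (_∘_)
open import Relation.Nullary using (Dec; yes; no; contradiction)
open import Relation.Nullary.Decidable using (⌊_⌋; from-yes; _⊎-dec_)
open import Relation.Binary.PropositionalEquality

sumF-cong : ∀ {n} {f g : Fin n → ℕ} → (∀ i → f i ≡ g i) → sumF f ≡ sumF g
sumF-cong {zero}  f≗g = refl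
sumF-cong {suc n} f≗g = cong₂ _+_ (f≗g zero) (sumF-cong (f≗g ∘ suc))

sumF-+ : ∀ {n} (f g : Fin n → ℕ) → sumF (λ i → f i + g i) ≡ sumF f + sumF g
sumF-+ {zero}  f g = refl
sumF-+ {suc n} f g = begin
  f zero + g zero + sumF (λ i → f (suc i) + g (suc i))
    ≡⟨ cong (f zero + g zero +_) (sumF-+ (f ∘ suc) (g ∘ suc)) ⟩
  f zero + g zero + (sumF (f ∘ suc) + sumF (g ∘ suc))
    ≡⟨ +-+-interchange (f zero) (g zero) _ _ ⟩
  f zero + sumF (f ∘ suc) + (g zero + sumF (g ∘ suc)) ∎
  where
  open ≡-Reasoning
  +-+-interchange : ∀ a b c d → a + b + (c + d) ≡ a + c + (b + d)
  +-+-interchange = solve-∀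

sumF-*ˡ : ∀ {n} x (f : Fin n → ℕ) → sumF (λ i → x * f i) ≡ x * sumF f
sumF-*ˡ {zero}  x f = sym (*-zeroʳ x)
sumF-*ˡ {suc n} x f =
  trans (cong (x * f zero +_) (sumF-*ˡ x (f ∘ suc))) (sym (*-distribˡ-+ x (f zero) _))

sumF-*ʳ : ∀ {n} x (f : Fin n → ℕ) → sumF (λ i → f i * x) ≡ sumF f * x
sumF-*ʳ x f = trans (sumF-cong (λ i → *-comm (f i) x)) (trans (sumF-*ˡ x f) (*-comm x _))

sumF-const : ∀ {n} x → sumF {n} (λ _ → x) ≡ n * x
sumF-const {zero}  x = refl
sumF-const {suc n} x = cong (x +_) (sumF-const {n} x)

sumF-zero : ∀ {n} {f : Fin n → ℕ} → (∀ i → f i ≡ 0) → sumF f ≡ 0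
sumF-zero {n} f≡0 = trans (sumF-cong f≡0) (trans (sumF-const {n} 0) (*-zeroʳ n))

sumF-swap : ∀ {m n} (f : Fin m → Fin n → ℕ) →
  sumF (λ i → sumF (f i)) ≡ sumF (λ j → sumF (λ i → f i j))
sumF-swap {zero}  {n} f = sym (trans (sumF-const {n} 0) (*-zeroʳ n))
sumF-swap {suc m} f =
  trans (cong (sumF (f zero) +_) (sumF-swap (f ∘ suc)))
        (sym (sumF-+ (f zero) (λ j → sumF (λ i → f (suc i) j))))

sumF-*-sumF : ∀ {m n} (f : Fin m → ℕ) (g : Fin n → ℕ) →
  sumF f * sumF g ≡ sumF (λ i → sumF (λ j → f i * g j))
sumF-*-sumF f g =
  trans (sym (sumF-*ʳ (sumF g) f)) (sumF-cong (λ i → sym (sumF-*ˡ (f i) g)))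

sumF-mono-≤ : ∀ {n} {f g : Fin n → ℕ} → (∀ i → f i ≤ g i) → sumF f ≤ sumF g
sumF-mono-≤ {zero}  f≤g = ≤-refl
sumF-mono-≤ {suc n} f≤g = +-mono-≤ (f≤g zero) (sumF-mono-≤ (f≤g ∘ suc))

sumF-removeAt : ∀ {n} (f : Fin (suc n) → ℕ) i → sumF f ≡ f i + sumF (removeAt f i)
sumF-removeAt         f zero    = refl
sumF-removeAt {suc n} f (suc i) =
  trans (cong (f zero +_) (sumF-removeAt (f ∘ suc) i))
        (+-comm-middle (f zero) (f (suc i)) _)
  where
  +-comm-middle : ∀ a b c → a + (b + c) ≡ b + (a + c)
  +-comm-middle = solve-∀

≤-sumF : ∀ {n} (f : Fin n → ℕ) i → f i ≤ sumF f
≤-sumF {suc n} f i = subst (f i ≤_) (sym (sumF-removeAt f i)) (m≤m+n (f i) _)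

+-≤-sumF : ∀ {n} (f : Fin n → ℕ) {i i'} → i ≢ i' → f i + f i' ≤ sumF f
+-≤-sumF {suc n} f {i} {i'} i≢i' = begin
  f i + f i'                                ≡⟨ cong (λ j → f i + f j) (punchIn-punchOut i≢i') ⟨
  f i + removeAt f i (punchOut i≢i')        ≤⟨ +-monoʳ-≤ (f i) (≤-sumF (removeAt f i) _) ⟩
  f i + sumF (removeAt f i)                 ≡⟨ sumF-removeAt f i ⟨
  sumF f                                    ∎
  where open ≤-Reasoning

sumF-single : ∀ {m} (g : Fin m → ℕ) i {u v} → g i ≡ u → (∀ j → j ≢ i → g j ≡ v) →
  sumF g ≡ u + (m ∸ 1) * v
sumF-single {suc m} g i {v = v} gi≡u others =
  trans (sumF-removeAt g i)
        (cong₂ _+_ gi≡u (trans (sumF-cong (λ j → others _ (punchInᵢ≢i i j))) (sumF-const {m} v)))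

sumF-pair : ∀ {m} (g : Fin m → ℕ) {i i' u w v} → i ≢ i' → g i ≡ u → g i' ≡ w →
  (∀ j → j ≢ i → j ≢ i' → g j ≡ v) → sumF g ≡ u + w + (m ∸ 2) * v
sumF-pair {suc m} g {i} {i'} {u} {w} i≢i' gi≡u gi'≡w others =
  trans (sumF-removeAt g i)
        (trans (cong₂ _+_ gi≡u (sumF-single (removeAt g i) (punchOut i≢i') gi'≡w′ others′))
               (sym (+-assoc u w _)))
  where
  gi'≡w′ : removeAt g i (punchOut i≢i') ≡ w
  gi'≡w′ = trans (cong g (punchIn-punchOut i≢i')) gi'≡w
  others′ : ∀ j → j ≢ punchOut i≢i' → removeAt g i j ≡ _
  others′ j j≢ = others _ (punchInᵢ≢i i j) λ eq →
    j≢ (punchIn-injective i j _ (trans eq (sym (punchIn-punchOut i≢i'))))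

sumF-≤-≡⇒≡ : ∀ {n} (f g : Fin n → ℕ) → (∀ i → g i ≤ f i) → sumF f ≡ sumF g →
  ∀ i → f i ≡ g i
sumF-≤-≡⇒≡ {suc n} f g g≤f Σf≡Σg i = ≤-antisym fi≤gi (g≤f i)
  where
  open ≤-Reasoning
  fi≤gi : f i ≤ g i
  fi≤gi = +-cancelʳ-≤ (sumF (removeAt g i)) (f i) (g i) (begin
    f i + sumF (removeAt g i) ≤⟨ +-monoʳ-≤ (f i) (sumF-mono-≤ (g≤f ∘ punchIn i)) ⟩
    f i + sumF (removeAt f i) ≡⟨ sumF-removeAt f i ⟨
    sumF f                    ≡⟨ Σf≡Σg ⟩
    sumF g                    ≡⟨ sumF-removeAt g i ⟩
    g i + sumF (removeAt g i) ∎)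

open ≡-Reasoning

module _ {n : ℕ} {d o : ℕ} where

  IJ-diag : (a : Fin n) → IJ d o a a ≡ d
  IJ-diag a with a ≟ a
  ... | yes _  = refl
  ... | no a≢a = contradiction refl a≢a

  IJ-offDiag : {a a' : Fin n} → a ≢ a' → IJ d o a a' ≡ o
  IJ-offDiag {a} {a'} a≢a' with a ≟ a'
  ... | yes a≡a' = contradiction a≡a' a≢a'
  ... | no _     = refl

  IJ-sym : (a a' : Fin n) → IJ d o a a' ≡ IJ d o a' a
  IJ-sym a a' with a ≟ a'
  ... | yes refl = sym (IJ-diag a)
  ... | no a≢a'  = sym (IJ-offDiag (a≢a' ∘ sym))

  IJ-intro : {v : ℕ} (a a' : Fin n) → (a ≡ a' → v ≡ d) → (a ≢ a' → v ≡ o) → v ≡ IJ d o a a'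
  IJ-intro a a' diag offDiag with a ≟ a'
  ... | yes a≡a' = diag a≡a'
  ... | no a≢a'  = offDiag a≢a'

  IJ-map : (f : ℕ → ℕ) (a a' : Fin n) → f (IJ d o a a') ≡ IJ (f d) (f o) a a'
  IJ-map f a a' with a ≟ a'
  ... | yes _ = refl
  ... | no _  = refl

  IJ-zip : ∀ {d' o'} (f : ℕ → ℕ → ℕ) (a a' : Fin n) →
    f (IJ d o a a') (IJ d' o' a a') ≡ IJ (f d d') (f o o') a a'
  IJ-zip f a a' with a ≟ a'
  ... | yes _ = refl
  ... | no _  = refl

sumF-IJ-select : ∀ {n} (h : Fin n → ℕ) (a : Fin n) → sumF (λ c → IJ (h c) 0 a c) ≡ h a
sumF-IJ-select {n} h a =
  trans (sumF-single (λ c → IJ (h c) 0 a c) a (IJ-diag a) (λ c c≢a → IJ-offDiag (c≢a ∘ sym)))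
        (trans (cong (h a +_) (*-zeroʳ (n ∸ 1))) (+-identityʳ (h a)))

infixl 9 _ᵀ
infixl 7 _·ᵀ_
infixl 6 _⊞_

_ᵀ : ∀ {n} → Mat n → Mat n
(A ᵀ) a c = A c a

_·ᵀ_ : ∀ {n} → Mat n → Mat n → Mat n
(A ·ᵀ B) a a' = sumF (λ c → A a c * B a' c)

_⊞_ : ∀ {n} → Mat n → Mat n → Mat n
(M ⊞ M') a a' = M a a' + M' a a'

rowSum : ∀ {n} → Mat n → Fin n → ℕ
rowSum A a = sumF (λ c → A a c)

colSum : ∀ {n} → Mat n → Fin n → ℕ
colSum A c = sumF (λ a → A a c)

IsIJ : ∀ {n} → ℕ → ℕ → Mat n → Set
IsIJ x y M = ∀ a a' → M a a' ≡ IJ x y a a'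

total : ∀ {n} → Mat n → ℕ
total M = sumF (λ c → sumF (λ c' → M c c'))

trace : ∀ {n} → Mat n → ℕ
trace M = sumF (λ c → M c c)

frob : ∀ {n} → Mat n → Mat n → ℕ
frob M M' = total (λ c c' → M c c' * M' c c')

·ᵀ-comm : ∀ {n} (A B : Mat n) a a' → (A ·ᵀ B) a a' ≡ (B ·ᵀ A) a' a
·ᵀ-comm A B a a' = sumF-cong (λ c → *-comm (A a c) (B a' c))

sumF-·ᵀ : ∀ {n k} (A B : Mat n) → (∀ c → colSum B c ≡ k) → ∀ a → sumF ((A ·ᵀ B) a) ≡ rowSum A a * k
sumF-·ᵀ {k = k} A B colB a = begin
  sumF (λ a' → sumF (λ c → A a c * B a' c)) ≡⟨ sumF-swap (λ a' c → A a c * B a' c) ⟩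
  sumF (λ c → sumF (λ a' → A a c * B a' c)) ≡⟨ sumF-cong (λ c → sumF-*ˡ (A a c) (λ a' → B a' c)) ⟩
  sumF (λ c → A a c * colSum B c)           ≡⟨ sumF-cong (λ c → cong (A a c *_) (colB c)) ⟩
  sumF (λ c → A a c * k)                    ≡⟨ sumF-*ʳ k (A a) ⟩
  rowSum A a * k                            ∎

IsIJ-⊞-comm : ∀ {n x y} {M M' : Mat n} → IsIJ x y (M ⊞ M') → IsIJ x y (M' ⊞ M)
IsIJ-⊞-comm {M = M} {M'} M⊞M'≡ a a' = trans (+-comm (M' a a') (M a a')) (M⊞M'≡ a a')

IsIJ-offDiagonal : ∀ {n x y y'} {M : Mat n} → (∀ {a a'} → a ≢ a' → y' ≡ y) → IsIJ x y M → IsIJ x y' M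
IsIJ-offDiagonal y'≡y M≡ a a' =
  trans (M≡ a a') (IJ-intro a a' (λ { refl → IJ-diag a }) (λ a≢a' → trans (IJ-offDiag a≢a') (sym (y'≡y a≢a'))))

identity : ∀ {n} → Mat n
identity = IJ 1 0

·ᵀ-identity : ∀ {n} (M : Mat n) a a' → (M ·ᵀ identity) a a' ≡ M a a'
·ᵀ-identity M a a' =
  trans (sumF-cong (λ c → trans (IJ-map (M a c *_) a' c)
                                (cong₂ (λ d o → IJ d o a' c) (*-identityʳ (M a c)) (*-zeroʳ (M a c)))))
        (sumF-IJ-select (M a) a')

-- Moments of natural matrices

square-+-square : ∀ x y → x * x + y * y ≡ x * y + x * y + ∣ x - y ∣ * ∣ x - y ∣
square-+-square zero    y       = refl
square-+-square (suc x) zero    =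
  trans (+-identityʳ _) (cong (λ t → t + t + suc x * suc x) (sym (*-zeroʳ (suc x))))
square-+-square (suc x) (suc y) = begin
  suc x * suc x + suc y * suc y                               ≡⟨ expand x y ⟩
  x * x + y * y + (2 + x + x + y + y)                         ≡⟨ cong (_+ (2 + x + x + y + y)) (square-+-square x y) ⟩
  x * y + x * y + ∣ x - y ∣ * ∣ x - y ∣ + (2 + x + x + y + y) ≡⟨ regroup x y _ ⟩
  suc x * suc y + suc x * suc y + ∣ x - y ∣ * ∣ x - y ∣       ∎
  where
  expand : ∀ x y → suc x * suc x + suc y * suc y ≡ x * x + y * y + (2 + x + x + y + y)
  expand = solve-∀
  regroup : ∀ x y e → x * y + x * y + e + (2 + x + x + y + y) ≡ suc x * suc y + suc x * suc y + e
  regroup = solve-∀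

xy+xy≤xx+yy : ∀ x y → x * y + x * y ≤ x * x + y * y
xy+xy≤xx+yy x y = subst (x * y + x * y ≤_) (sym (square-+-square x y)) (m≤m+n _ _)

xx+yy≡xy+xy⇒x≡y : ∀ x y → x * x + y * y ≡ x * y + x * y → x ≡ y
xx+yy≡xy+xy⇒x≡y x y eq = ∣m-n∣≡0⇒m≡n (reduce (m*n≡0⇒m≡0∨n≡0 ∣ x - y ∣ gap²))
  where
  gap² : ∣ x - y ∣ * ∣ x - y ∣ ≡ 0
  gap² = +-cancelˡ-≡ (x * y + x * y) _ 0
           (trans (sym (square-+-square x y)) (trans eq (sym (+-identityʳ _))))

module _ {n : ℕ} where

  total-cong : {M M' : Mat n} → (∀ c c' → M c c' ≡ M' c c') → total M ≡ total M'
  total-cong M≗M' = sumF-cong (sumF-cong ∘ M≗M')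

  total-⊞ : (M M' : Mat n) → total (M ⊞ M') ≡ total M + total M'
  total-⊞ M M' = trans (sumF-cong (λ c → sumF-+ (M c) (M' c))) (sumF-+ {n} _ _)

  total-*ˡ : (x : ℕ) (M : Mat n) → total (λ c c' → x * M c c') ≡ x * total M
  total-*ˡ x M = trans (sumF-cong (λ c → sumF-*ˡ x (M c))) (sumF-*ˡ {n} x _)

  total-≤-≡⇒≡ : (M M' : Mat n) → (∀ c c' → M' c c' ≤ M c c') → total M ≡ total M' →
    ∀ c c' → M c c' ≡ M' c c'
  total-≤-≡⇒≡ M M' M'≤M ΣM≡ΣM' c =
    sumF-≤-≡⇒≡ (M c) (M' c) (M'≤M c)
      (sumF-≤-≡⇒≡ _ _ (λ c → sumF-mono-≤ (M'≤M c)) ΣM≡ΣM' c)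

  total-IJ : (x y : ℕ) → total (IJ {n} x y) ≡ n * (x + (n ∸ 1) * y)
  total-IJ x y = trans (sumF-cong (λ c → sumF-single {n} _ c (IJ-diag c) (λ _ c'≢c → IJ-offDiag (c'≢c ∘ sym))))
                       (sumF-const {n} _)

  total-·ᵀ : (F G : Mat n) → total (F ·ᵀ G) ≡ sumF (λ c → colSum F c * colSum G c)
  total-·ᵀ F G = begin
    sumF (λ a → sumF (λ a' → sumF (λ c → F a c * G a' c)))
      ≡⟨ sumF-cong (λ a → sumF-swap (λ a' c → F a c * G a' c)) ⟩
    sumF (λ a → sumF (λ c → sumF (λ a' → F a c * G a' c)))
      ≡⟨ sumF-swap {n} {n} _ ⟩
    sumF (λ c → sumF (λ a → sumF (λ a' → F a c * G a' c)))
      ≡⟨ sumF-cong (λ c → sumF-*-sumF (λ a → F a c) (λ a' → G a' c)) ⟨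
    sumF (λ c → colSum F c * colSum G c) ∎

  total-·ᵀ-const : ∀ {p q} {F G : Mat n} → (∀ c → colSum F c ≡ p) → (∀ c → colSum G c ≡ q) →
    total (F ·ᵀ G) ≡ n * (p * q)
  total-·ᵀ-const {p} {q} {F} {G} colF colG =
    trans (total-·ᵀ F G) (trans (sumF-cong (λ c → cong₂ _*_ (colF c) (colG c))) (sumF-const {n} (p * q)))

  trace-⊞ : (M M' : Mat n) → trace (M ⊞ M') ≡ trace M + trace M'
  trace-⊞ M M' = sumF-+ {n} _ _

  trace-ᵀ : (F G : Mat n) → trace (F ᵀ ·ᵀ G ᵀ) ≡ trace (F ·ᵀ G)
  trace-ᵀ F G = sumF-swap (λ c a → F a c * G a c)

  frob-cong : {M M' N N' : Mat n} → (∀ c c' → M c c' ≡ M' c c') → (∀ c c' → N c c' ≡ N' c c') →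
    frob M N ≡ frob M' N'
  frob-cong M≗M' N≗N' = total-cong (λ c c' → cong₂ _*_ (M≗M' c c') (N≗N' c c'))

  frob-comm : (M N : Mat n) → frob M N ≡ frob N M
  frob-comm M N = total-cong (λ c c' → *-comm (M c c') (N c c'))

  frob-⊞ˡ : (M M' N : Mat n) → frob (M ⊞ M') N ≡ frob M N + frob M' N
  frob-⊞ˡ M M' N = trans (total-cong (λ c c' → *-distribʳ-+ (N c c') (M c c') (M' c c'))) (total-⊞ _ _)

  frob-⊞ʳ : (M N N' : Mat n) → frob M (N ⊞ N') ≡ frob M N + frob M N'
  frob-⊞ʳ M N N' = trans (total-cong (λ c c' → *-distribˡ-+ (M c c') (N c c') (N' c c'))) (total-⊞ _ _)

  frob-⊞-⊞ : (M N : Mat n) → frob (M ⊞ N) (M ⊞ N) ≡ frob M M + frob M N + (frob N M + frob N N)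
  frob-⊞-⊞ M N = trans (frob-⊞ˡ M N _) (cong₂ _+_ (frob-⊞ʳ M M N) (frob-⊞ʳ N M N))

  -- ⟨M , xI + y(J − I)⟩ = x tr M + y (ΣM − tr M), with the subtraction moved across
  frob-IJ : (M : Mat n) (x y : ℕ) → frob M (IJ x y) + y * trace M ≡ x * trace M + y * total M
  frob-IJ M x y = begin
    frob M (IJ x y) + y * trace M              ≡⟨ cong (λ t → frob M (IJ x y) + y * t) diagonal ⟨
    frob M (IJ x y) + y * total D              ≡⟨ cong (frob M (IJ x y) +_) (total-*ˡ y D) ⟨
    frob M (IJ x y) + total (λ c c' → y * D c c')  ≡⟨ total-⊞ _ _ ⟨
    total (λ c c' → M c c' * IJ x y c c' + y * D c c') ≡⟨ total-cong split ⟩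
    total (λ c c' → x * D c c' + y * M c c')  ≡⟨ total-⊞ _ _ ⟩
    total (λ c c' → x * D c c') + total (λ c c' → y * M c c') ≡⟨ cong₂ _+_ (total-*ˡ x D) (total-*ˡ y M) ⟩
    x * total D + y * total M                 ≡⟨ cong (λ t → x * t + y * total M) diagonal ⟩
    x * trace M + y * total M                 ∎
    where
    D : Mat n
    D c c' = IJ (M c c') 0 c c'
    diagonal : total D ≡ trace M
    diagonal = sumF-cong (λ c → sumF-IJ-select (M c) c)
    split : ∀ c c' → M c c' * IJ x y c c' + y * D c c' ≡ x * D c c' + y * M c c'
    split c c' with c ≟ c'
    ... | yes _ = onDiagonal (M c c') x y
      where
      onDiagonal : ∀ m x y → m * x + y * m ≡ x * m + y * m
      onDiagonal = solve-∀
    ... | no _  = offDiagonal (M c c') x y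
      where
      offDiagonal : ∀ m x y → m * y + y * 0 ≡ x * 0 + y * m
      offDiagonal = solve-∀

  -- Σ (M − Q)² = 0 without subtraction: M² + Q² ≥ 2MQ, with equality only where M = Q
  frob-≡⇒≡ : (M Q : Mat n) → frob M M ≡ frob Q Q → frob M Q ≡ frob Q Q →
    ∀ c c' → M c c' ≡ Q c c'
  frob-≡⇒≡ M Q MM≡QQ MQ≡QQ c c' =
    xx+yy≡xy+xy⇒x≡y (M c c') (Q c c')
      (total-≤-≡⇒≡ squares products (λ c c' → xy+xy≤xx+yy (M c c') (Q c c')) Σ≡ c c')
    where
    squares products : Mat n
    squares  c c' = M c c' * M c c' + Q c c' * Q c c'
    products c c' = M c c' * Q c c' + M c c' * Q c c'
    Σ≡ : total squares ≡ total products
    Σ≡ = begin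
      total squares          ≡⟨ total-⊞ _ _ ⟩
      frob M M + frob Q Q    ≡⟨ cong₂ _+_ (trans MM≡QQ (sym MQ≡QQ)) (sym MQ≡QQ) ⟩
      frob M Q + frob M Q    ≡⟨ total-⊞ _ _ ⟨
      total products         ∎

  IsIJ-by-moments : (x y : ℕ) (M : Mat n) → frob M M ≡ frob (IJ {n} x y) (IJ x y) →
    trace M ≡ trace (IJ {n} x y) → total M ≡ total (IJ {n} x y) → IsIJ x y M
  IsIJ-by-moments x y M MM≡QQ trM≡trQ ΣM≡ΣQ = frob-≡⇒≡ M Q MM≡QQ MQ≡QQ
    where
    Q = IJ {n} x y
    MQ≡QQ : frob M Q ≡ frob Q Q
    MQ≡QQ = +-cancelʳ-≡ (y * trace Q) _ _ (begin
      frob M Q + y * trace Q   ≡⟨ cong (λ t → frob M Q + y * t) trM≡trQ ⟨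
      frob M Q + y * trace M   ≡⟨ frob-IJ M x y ⟩
      x * trace M + y * total M ≡⟨ cong₂ (λ t s → x * t + y * s) trM≡trQ ΣM≡ΣQ ⟩
      x * trace Q + y * total Q ≡⟨ frob-IJ Q x y ⟨
      frob Q Q + y * trace Q   ∎)

  -- cyclicity of the trace: both sides are the sum of F a c * G a c' * H b c * K b c'
  frob-ᵀ : (F G H K : Mat n) → frob (F ᵀ ·ᵀ G ᵀ) (H ᵀ ·ᵀ K ᵀ) ≡ frob (F ·ᵀ H) (G ·ᵀ K)
  frob-ᵀ F G H K = begin
    total (λ c c' → (F ᵀ ·ᵀ G ᵀ) c c' * (H ᵀ ·ᵀ K ᵀ) c c')
      ≡⟨ total-cong (λ c c' → sumF-*-sumF (λ a → F a c * G a c') (λ b → H b c * K b c')) ⟩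
    sumF (λ c → sumF (λ c' → sumF (λ a → sumF (λ b → ψ c c' a b))))
      ≡⟨ sumF-cong (λ c → sumF-swap (λ c' a → sumF (ψ c c' a))) ⟩
    sumF (λ c → sumF (λ a → sumF (λ c' → sumF (λ b → ψ c c' a b))))
      ≡⟨ sumF-cong (λ c → sumF-cong (λ a → sumF-swap (λ c' b → ψ c c' a b))) ⟩
    sumF (λ c → sumF (λ a → sumF (λ b → sumF (λ c' → ψ c c' a b))))
      ≡⟨ sumF-swap (λ c a → sumF (λ b → sumF (λ c' → ψ c c' a b))) ⟩
    sumF (λ a → sumF (λ c → sumF (λ b → sumF (λ c' → ψ c c' a b))))
      ≡⟨ sumF-cong (λ a → sumF-swap (λ c b → sumF (λ c' → ψ c c' a b))) ⟩
    sumF (λ a → sumF (λ b → sumF (λ c → sumF (λ c' → ψ c c' a b))))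
      ≡⟨ total-cong (λ a b → total-cong (λ c c' → interchange (F a c) (G a c') (H b c) (K b c'))) ⟩
    sumF (λ a → sumF (λ b → sumF (λ c → sumF (λ c' → F a c * H b c * (G a c' * K b c')))))
      ≡⟨ total-cong (λ a b → sumF-*-sumF (λ c → F a c * H b c) (λ c' → G a c' * K b c')) ⟨
    total (λ a b → (F ·ᵀ H) a b * (G ·ᵀ K) a b) ∎
    where
    ψ : Fin n → Fin n → Fin n → Fin n → ℕ
    ψ c c' a b = F a c * G a c' * (H b c * K b c')
    interchange : ∀ f g h k → f * g * (h * k) ≡ f * h * (g * k)
    interchange = solve-∀

  transpose-crossGram : ∀ {p q x y} (F G : Mat n) →
    (∀ a → rowSum F a ≡ p) → (∀ c → colSum F c ≡ p) →
    (∀ a → rowSum G a ≡ q) → (∀ c → colSum G c ≡ q) →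
    frob (F ·ᵀ F) (G ·ᵀ G) ≡ frob (F ᵀ ·ᵀ F ᵀ) (G ᵀ ·ᵀ G ᵀ) →
    IsIJ x y (F ·ᵀ G ⊞ G ·ᵀ F) → IsIJ x y (F ᵀ ·ᵀ G ᵀ ⊞ G ᵀ ·ᵀ F ᵀ)
  transpose-crossGram {p} {q} {x} {y} F G rowF colF rowG colG FF-GG S≡Q =
    IsIJ-by-moments x y T
      (trans TT≡SS (frob-cong S≡Q S≡Q))
      (trans (trans (trace-⊞ (F ᵀ ·ᵀ G ᵀ) (G ᵀ ·ᵀ F ᵀ)) (cong₂ _+_ (trace-ᵀ F G) (trace-ᵀ G F)))
             (trans (sym (trace-⊞ (F ·ᵀ G) (G ·ᵀ F))) (sumF-cong (λ c → S≡Q c c))))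
      (trans ΣT≡ΣS (total-cong S≡Q))
    where
    T S : Mat n
    T = F ᵀ ·ᵀ G ᵀ ⊞ G ᵀ ·ᵀ F ᵀ
    S = F ·ᵀ G ⊞ G ·ᵀ F
    TT≡SS : frob T T ≡ frob S S
    TT≡SS = begin
      frob T T
        ≡⟨ frob-⊞-⊞ (F ᵀ ·ᵀ G ᵀ) (G ᵀ ·ᵀ F ᵀ) ⟩
      frob (F ᵀ ·ᵀ G ᵀ) (F ᵀ ·ᵀ G ᵀ) + frob (F ᵀ ·ᵀ G ᵀ) (G ᵀ ·ᵀ F ᵀ)
        + (frob (G ᵀ ·ᵀ F ᵀ) (F ᵀ ·ᵀ G ᵀ) + frob (G ᵀ ·ᵀ F ᵀ) (G ᵀ ·ᵀ F ᵀ))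
        ≡⟨ cong₂ _+_ (cong₂ _+_ (frob-ᵀ F G F G) (frob-ᵀ F G G F))
                     (cong₂ _+_ (frob-ᵀ G F F G) (frob-ᵀ G F G F)) ⟩
      frob (F ·ᵀ F) (G ·ᵀ G) + frob (F ·ᵀ G) (G ·ᵀ F)
        + (frob (G ·ᵀ F) (F ·ᵀ G) + frob (G ·ᵀ G) (F ·ᵀ F))
        ≡⟨ cong₂ _+_ (cong (_+ frob (F ·ᵀ G) (G ·ᵀ F)) FF-GG)
                     (cong (frob (G ·ᵀ F) (F ·ᵀ G) +_)
                       (trans (frob-comm (G ·ᵀ G) (F ·ᵀ F))
                         (trans FF-GG (frob-comm (F ᵀ ·ᵀ F ᵀ) (G ᵀ ·ᵀ G ᵀ))))) ⟩
      frob (F ᵀ ·ᵀ F ᵀ) (G ᵀ ·ᵀ G ᵀ) + frob (F ·ᵀ G) (G ·ᵀ F)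
        + (frob (G ·ᵀ F) (F ·ᵀ G) + frob (G ᵀ ·ᵀ G ᵀ) (F ᵀ ·ᵀ F ᵀ))
        ≡⟨ cong₂ _+_ (cong (_+ frob (F ·ᵀ G) (G ·ᵀ F)) (frob-ᵀ F F G G))
                     (cong (frob (G ·ᵀ F) (F ·ᵀ G) +_) (frob-ᵀ G G F F)) ⟩
      frob (F ·ᵀ G) (F ·ᵀ G) + frob (F ·ᵀ G) (G ·ᵀ F)
        + (frob (G ·ᵀ F) (F ·ᵀ G) + frob (G ·ᵀ F) (G ·ᵀ F))
        ≡⟨ frob-⊞-⊞ (F ·ᵀ G) (G ·ᵀ F) ⟨
      frob S S ∎
    ΣT≡ΣS : total T ≡ total S
    ΣT≡ΣS = begin
      total T                                 ≡⟨ total-⊞ (F ᵀ ·ᵀ G ᵀ) (G ᵀ ·ᵀ F ᵀ) ⟩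
      total (F ᵀ ·ᵀ G ᵀ) + total (G ᵀ ·ᵀ F ᵀ) ≡⟨ cong₂ _+_ (total-·ᵀ-const rowF rowG) (total-·ᵀ-const rowG rowF) ⟩
      n * (p * q) + n * (q * p)               ≡⟨ cong₂ _+_ (total-·ᵀ-const colF colG) (total-·ᵀ-const colG colF) ⟨
      total (F ·ᵀ G) + total (G ·ᵀ F)         ≡⟨ total-⊞ (F ·ᵀ G) (G ·ᵀ F) ⟨
      total S                                 ∎

-- Regular symmetric designs

binary-square : ∀ {x} → x ≡ 0 ⊎ x ≡ 1 → x * x ≡ x
binary-square (inj₁ refl) = refl
binary-square (inj₂ refl) = refl

record IsRegularSymDesign (n k l : ℕ) (A : Mat n) : Set where
  field
    binary  : Binary A
    rowSum≡ : ∀ a → rowSum A a ≡ k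
    colSum≡ : ∀ c → colSum A c ≡ k
    gram    : IsIJ k l (A ·ᵀ A)

record IsRegularPair {n} (A B : Mat n) (k₁ k₂ l₁ l₂ μ₁ μ₂ : ℕ) : Set where
  field
    design₁   : IsRegularSymDesign n k₁ l₁ A
    design₂   : IsRegularSymDesign n k₂ l₂ B
    crossGram : IsIJ μ₁ μ₂ (A ·ᵀ B ⊞ B ·ᵀ A)

module _ {n k l : ℕ} {A : Mat n} (D : IsRegularSymDesign n k l A) where
  open IsRegularSymDesign D

  toSymDesign : IsSymDesign n k l A
  toSymDesign = binary , colSum≡ , λ a a' a≢a' → trans (gram a a') (IJ-offDiag a≢a')

  transpose-design : IsRegularSymDesign n k l (A ᵀ)
  transpose-design = record
    { binary  = λ a c → binary c a
    ; rowSum≡ = colSum≡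
    ; colSum≡ = rowSum≡
    ; gram    = IsIJ-halve (transpose-crossGram A A rowSum≡ colSum≡ rowSum≡ colSum≡
                  (sym (frob-ᵀ A A A A))
                  (λ a a' → trans (cong₂ _+_ (gram a a') (gram a a')) (IJ-map (λ t → t + t) a a')))
    }
    where
    +-double-injective : ∀ {s t} → s + s ≡ t + t → s ≡ t
    +-double-injective {s} {t} eq = *-cancelˡ-≡ s t 2 (trans (cong (s +_) (+-identityʳ s))
                                      (trans eq (sym (cong (t +_) (+-identityʳ t)))))
    IsIJ-halve : ∀ {x y} {M : Mat n} → IsIJ (x + x) (y + y) (M ⊞ M) → IsIJ x y M
    IsIJ-halve M⊞M≡ a a' = +-double-injective (trans (M⊞M≡ a a') (sym (IJ-map (λ t → t + t) a a')))

transpose-pair : ∀ {n} {A B : Mat n} {k₁ k₂ l₁ l₂ μ₁ μ₂} →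
  IsRegularPair A B k₁ k₂ l₁ l₂ μ₁ μ₂ → IsRegularPair (A ᵀ) (B ᵀ) k₁ k₂ l₁ l₂ μ₁ μ₂
transpose-pair {A = A} {B} P = record
  { design₁   = transpose-design design₁
  ; design₂   = transpose-design design₂
  ; crossGram = transpose-crossGram A B (rowSum≡ design₁) (colSum≡ design₁)
                  (rowSum≡ design₂) (colSum≡ design₂)
                  (trans (frob-cong (gram design₁) (gram design₂))
                    (sym (frob-cong (gram (transpose-design design₁)) (gram (transpose-design design₂)))))
                  crossGram
  }
  where
  open IsRegularPair P
  open IsRegularSymDesign

-- The block construction

blockMatrix : ∀ {m n} → Mat n → Mat n → MatR m n
blockMatrix A B (i , a) (j , c) = if ⌊ i ≟ j ⌋ then A a c else B a c

record IsBlockMatrix {m n} (A B : Mat n) (N : MatR m n) : Set where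
  field
    diagonal    : ∀ i a c → N (i , a) (i , c) ≡ A a c
    offDiagonal : ∀ {i j} → i ≢ j → ∀ a c → N (i , a) (j , c) ≡ B a c

blockMatrix-isBlockMatrix : ∀ {m n} {A B : Mat n} → IsBlockMatrix A B (blockMatrix {m} A B)
blockMatrix-isBlockMatrix {A = A} {B} = record { diagonal = diagonal ; offDiagonal = offDiagonal }
  where
  diagonal : ∀ i a c → blockMatrix A B (i , a) (i , c) ≡ A a c
  diagonal i a c with i ≟ i
  ... | yes _  = refl
  ... | no i≢i = contradiction refl i≢i
  offDiagonal : ∀ {i j} → i ≢ j → ∀ a c → blockMatrix A B (i , a) (j , c) ≡ B a c
  offDiagonal {i} {j} i≢j a c with i ≟ j
  ... | yes i≡j = contradiction i≡j i≢j
  ... | no _    = refl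

transposeR-isBlockMatrix : ∀ {m n} {A B : Mat n} {N : MatR m n} →
  IsBlockMatrix A B N → IsBlockMatrix (A ᵀ) (B ᵀ) (transposeR N)
transposeR-isBlockMatrix isBlock = record
  { diagonal    = λ i a c → diagonal i c a
  ; offDiagonal = λ i≢j a c → offDiagonal (i≢j ∘ sym) c a
  }
  where open IsBlockMatrix isBlock

module BlockDesign {m n} {A B : Mat n} {k₁ k₂ l₁ l₂ μ₁ μ₂ : ℕ}
  (P : IsRegularPair A B k₁ k₂ l₁ l₂ μ₁ μ₂) {N : MatR m n} (isBlock : IsBlockMatrix A B N) where

  open IsRegularPair P
  open IsRegularSymDesign
  open IsBlockMatrix isBlock

  private
    gram-at : ∀ {i i' j a a'} (X Y : Mat n) →
      (∀ c → N (i , a) (j , c) ≡ X a c) → (∀ c → N (i' , a') (j , c) ≡ Y a' c) →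
      sumF (λ c → N (i , a) (j , c) * N (i' , a') (j , c)) ≡ (X ·ᵀ Y) a a'
    gram-at X Y Nᵢ≡X Nᵢ'≡Y = sumF-cong (λ c → cong₂ _*_ (Nᵢ≡X c) (Nᵢ'≡Y c))

  conc-sameRow : ∀ i a a' → conc N (i , a) (i , a') ≡ IJ (k₁ + (m ∸ 1) * k₂) (l₁ + (m ∸ 1) * l₂) a a'
  conc-sameRow i a a' = begin
    conc N (i , a) (i , a')
      ≡⟨ sumF-single _ i (gram-at A A (diagonal i a) (diagonal i a'))
           (λ j j≢i → gram-at B B (offDiagonal (j≢i ∘ sym) a) (offDiagonal (j≢i ∘ sym) a')) ⟩
    (A ·ᵀ A) a a' + (m ∸ 1) * (B ·ᵀ B) a a'
      ≡⟨ cong₂ (λ s t → s + (m ∸ 1) * t) (gram design₁ a a') (gram design₂ a a') ⟩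
    IJ k₁ l₁ a a' + (m ∸ 1) * IJ k₂ l₂ a a'
      ≡⟨ cong (IJ k₁ l₁ a a' +_) (IJ-map ((m ∸ 1) *_) a a') ⟩
    IJ k₁ l₁ a a' + IJ ((m ∸ 1) * k₂) ((m ∸ 1) * l₂) a a'
      ≡⟨ IJ-zip _+_ a a' ⟩
    IJ (k₁ + (m ∸ 1) * k₂) (l₁ + (m ∸ 1) * l₂) a a' ∎

  conc-otherRow : ∀ i i' → i ≢ i' → ∀ a a' →
    conc N (i , a) (i' , a') ≡ IJ ((m ∸ 2) * k₂ + μ₁) ((m ∸ 2) * l₂ + μ₂) a a'
  conc-otherRow i i' i≢i' a a' = begin
    conc N (i , a) (i' , a')
      ≡⟨ sumF-pair _ i≢i' (gram-at A B (diagonal i a) (offDiagonal (i≢i' ∘ sym) a'))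
           (gram-at B A (offDiagonal i≢i' a) (diagonal i' a'))
           (λ j j≢i j≢i' → gram-at B B (offDiagonal (j≢i ∘ sym) a) (offDiagonal (j≢i' ∘ sym) a')) ⟩
    (A ·ᵀ B ⊞ B ·ᵀ A) a a' + (m ∸ 2) * (B ·ᵀ B) a a'
      ≡⟨ cong₂ (λ s t → s + (m ∸ 2) * t) (crossGram a a') (gram design₂ a a') ⟩
    IJ μ₁ μ₂ a a' + (m ∸ 2) * IJ k₂ l₂ a a'
      ≡⟨ +-comm (IJ μ₁ μ₂ a a') _ ⟩
    (m ∸ 2) * IJ k₂ l₂ a a' + IJ μ₁ μ₂ a a'
      ≡⟨ cong (_+ IJ μ₁ μ₂ a a') (IJ-map ((m ∸ 2) *_) a a') ⟩
    IJ ((m ∸ 2) * k₂) ((m ∸ 2) * l₂) a a' + IJ μ₁ μ₂ a a'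
      ≡⟨ IJ-zip _+_ a a' ⟩
    IJ ((m ∸ 2) * k₂ + μ₁) ((m ∸ 2) * l₂ + μ₂) a a' ∎

  isRD : IsRD m n (k₁ + (m ∸ 1) * k₂) (k₁ + (m ∸ 1) * k₂) (l₁ + (m ∸ 1) * l₂)
           ((m ∸ 2) * k₂ + μ₁) ((m ∸ 2) * l₂ + μ₂) N
  isRD = binaryN , colSumN , rowSumN
       , (λ i a a' a≢a' → trans (conc-sameRow i a a') (IJ-offDiag a≢a'))
       , (λ i i' a i≢i' → trans (conc-otherRow i i' i≢i' a a) (IJ-diag a))
       , (λ i i' a a' i≢i' a≢a' → trans (conc-otherRow i i' i≢i' a a') (IJ-offDiag a≢a'))
    where
    binaryN : Binary N
    binaryN (i , a) (j , c) with i ≟ j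
    ... | yes refl = subst (λ v → v ≡ 0 ⊎ v ≡ 1) (sym (diagonal i a c)) (binary design₁ a c)
    ... | no i≢j   = subst (λ v → v ≡ 0 ⊎ v ≡ 1) (sym (offDiagonal i≢j a c)) (binary design₂ a c)
    colSumN : ∀ y → sum2 (λ x → N x y) ≡ k₁ + (m ∸ 1) * k₂
    colSumN (j , c) = sumF-single _ j
      (trans (sumF-cong (λ a → diagonal j a c)) (colSum≡ design₁ c))
      (λ i i≢j → trans (sumF-cong (λ a → offDiagonal i≢j a c)) (colSum≡ design₂ c))
    rowSumN : ∀ x → sum2 (λ y → N x y) ≡ k₁ + (m ∸ 1) * k₂
    rowSumN (i , a) = sumF-single _ i
      (trans (sumF-cong (diagonal i a)) (rowSum≡ design₁ a))
      (λ j j≢i → trans (sumF-cong (offDiagonal (j≢i ∘ sym) a)) (rowSum≡ design₂ a))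

blockDesign : ∀ {n} {A B : Mat n} {k₁ k₂ l₁ l₂ μ₁ μ₂} → IsRegularPair A B k₁ k₂ l₁ l₂ μ₁ μ₂ →
  (m : ℕ) →
    Σ (MatR m n) λ N →
      IsSDRD m n (k₁ + (m ∸ 1) * k₂) (k₁ + (m ∸ 1) * k₂)
        (l₁ + (m ∸ 1) * l₂) ((m ∸ 2) * k₂ + μ₁) ((m ∸ 2) * l₂ + μ₂) N
      × IsSTD N
      × IsGlobalDecomposable m n (k₁ + (m ∸ 1) * k₂)
          (l₁ + (m ∸ 1) * l₂) ((m ∸ 2) * k₂ + μ₁) ((m ∸ 2) * l₂ + μ₂) N
blockDesign {n} {A} {B} {k₁} {k₂} {l₁} {l₂} P m =
  N , (D.isRD , Dᵀ.isRD) , isSTD , blocks-symDesign , D.conc-sameRow , D.conc-otherRow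
  where
  open IsRegularPair P
  open IsRegularSymDesign
  N : MatR m n
  N = blockMatrix A B
  module D  = BlockDesign P blockMatrix-isBlockMatrix
  module Dᵀ = BlockDesign (transpose-pair P) (transposeR-isBlockMatrix blockMatrix-isBlockMatrix)
  isSTD : IsSTD N
  isSTD i j with i ≟ j
  ... | yes _ = (k₁ , rowSum≡ design₁) , (k₁ , colSum≡ design₁)
  ... | no _  = (k₂ , rowSum≡ design₂) , (k₂ , colSum≡ design₂)
  blocks-symDesign : ∀ i j → ∃ λ k → ∃ λ l → IsSymDesign n k l (sub N i j)
  blocks-symDesign i j with i ≟ j
  ... | yes _ = k₁ , l₁ , toSymDesign design₁
  ... | no _  = k₂ , l₂ , toSymDesign design₂

-- Regularising the given designs

rowSum-const : ∀ {n k s} (A : Mat n) → (∀ c → colSum A c ≡ k) →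
  (∀ a b → rowSum A a * suc s ≡ rowSum A b * suc s) → ∀ a → rowSum A a ≡ k
rowSum-const {suc n} {k} {s} A colA scaled a = *-cancelˡ-≡ (rowSum A a) k (suc n) (begin
  suc n * rowSum A a                   ≡⟨ sumF-const {suc n} (rowSum A a) ⟨
  sumF {suc n} (λ _ → rowSum A a)      ≡⟨ sumF-cong (λ b → *-cancelʳ-≡ (rowSum A a) (rowSum A b) (suc s) (scaled a b)) ⟩
  sumF (rowSum A)                      ≡⟨ sumF-swap (λ b c → A b c) ⟩
  sumF (colSum A)                      ≡⟨ sumF-cong colA ⟩
  sumF {suc n} (λ _ → k)               ≡⟨ sumF-const {suc n} k ⟩
  suc n * k                            ∎)

regular-of-rowSums : ∀ {n k l} {A : Mat n} → IsSymDesign n k l A → (∀ a → rowSum A a ≡ k) →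
  IsRegularSymDesign n k l A
regular-of-rowSums {k = k} {l} {A} (binaryA , colSumA , offDiagA) rowSumA = record
  { binary = binaryA ; rowSum≡ = rowSumA ; colSum≡ = colSumA ; gram = gramA }
  where
  gramA : IsIJ k l (A ·ᵀ A)
  gramA a a' = IJ-intro a a'
    (λ { refl → trans (sumF-cong (λ c → binary-square (binaryA a c))) (rowSumA a) })
    (offDiagA a a')

rowSum-counting : ∀ {n k l} {A : Mat n} → IsSymDesign n k l A →
  ∀ a → rowSum A a * k ≡ rowSum A a + (n ∸ 1) * l
rowSum-counting {A = A} (binaryA , colSumA , offDiagA) a =
  trans (sym (sumF-·ᵀ A A colSumA a))
        (sumF-single _ a (sumF-cong (λ c → binary-square (binaryA a c)))
                         (λ a' a'≢a → offDiagA a a' (a'≢a ∘ sym)))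

rowSum≡-of-≢1 : ∀ {n k l} {A : Mat n} → IsSymDesign n k l A → k ≢ 1 → ∀ a → rowSum A a ≡ k
rowSum≡-of-≢1 {k = zero} {A = A} D _ a =
  m+n≡0⇒m≡0 _ (trans (sym (rowSum-counting D a)) (*-zeroʳ (rowSum A a)))
rowSum≡-of-≢1 {k = suc zero} D k≢1 = contradiction refl k≢1
rowSum≡-of-≢1 {n} {suc (suc k)} {l} {A} D@(_ , colSumA , _) _ =
  rowSum-const A colSumA (λ a b → trans (scaled a) (sym (scaled b)))
  where
  scaled : ∀ a → rowSum A a * suc k ≡ (n ∸ 1) * l
  scaled a = +-cancelˡ-≡ (rowSum A a) _ _ (trans (sym (*-suc (rowSum A a) (suc k))) (rowSum-counting D a))

zero-of-k≡0 : ∀ {n l} {A : Mat n} → IsSymDesign n 0 l A → ∀ a c → A a c ≡ 0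
zero-of-k≡0 {A = A} (_ , colSumA , _) a c = n≤0⇒n≡0 (subst (A a c ≤_) (colSumA c) (≤-sumF (λ a → A a c) a))

l≡0-of-k≡1 : ∀ {n l} {A : Mat n} → IsSymDesign n 1 l A → ∀ {a a'} → a ≢ a' → l ≡ 0
l≡0-of-k≡1 {A = A} (_ , colSumA , offDiagA) {a} {a'} a≢a' =
  trans (sym (offDiagA a a' a≢a'))
        (sumF-zero (λ c → +≤1⇒*≡0 (A a c) (A a' c) (subst (A a c + A a' c ≤_) (colSumA c) (+-≤-sumF _ a≢a'))))
  where
  +≤1⇒*≡0 : ∀ x y → x + y ≤ 1 → x * y ≡ 0
  +≤1⇒*≡0 zero    y       _         = refl
  +≤1⇒*≡0 (suc x) zero    _         = *-zeroʳ x
  +≤1⇒*≡0 (suc x) (suc y) (s≤s x+1+y≤0) = contradiction (m+n≡0⇒n≡0 x (n≤0⇒n≡0 x+1+y≤0)) λ ()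

crossGram-rowSum : ∀ {n k₁ k₂ μ₁ μ₂} {A B : Mat n} →
  (∀ c → colSum A c ≡ k₁) → (∀ c → colSum B c ≡ k₂) → IsIJ μ₁ μ₂ (A ·ᵀ B ⊞ B ·ᵀ A) →
  ∀ a → rowSum A a * k₂ + rowSum B a * k₁ ≡ μ₁ + (n ∸ 1) * μ₂
crossGram-rowSum {k₁ = k₁} {k₂} {A = A} {B} colA colB cross a = begin
  rowSum A a * k₂ + rowSum B a * k₁
    ≡⟨ cong₂ _+_ (sumF-·ᵀ A B colB a) (sumF-·ᵀ B A colA a) ⟨
  sumF ((A ·ᵀ B) a) + sumF ((B ·ᵀ A) a)
    ≡⟨ sumF-+ ((A ·ᵀ B) a) ((B ·ᵀ A) a) ⟨
  sumF ((A ·ᵀ B ⊞ B ·ᵀ A) a)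
    ≡⟨ sumF-single _ a (trans (cross a a) (IJ-diag a)) (λ a' a'≢a → trans (cross a a') (IJ-offDiag (a'≢a ∘ sym))) ⟩
  _ ∎

crossGram-parameters : ∀ {n k₁ k₂ μ₁ μ₂} (A B : Mat n) .{{_ : NonZero n}} →
  (∀ c → colSum A c ≡ k₁) → (∀ c → colSum B c ≡ k₂) → IsIJ μ₁ μ₂ (A ·ᵀ B ⊞ B ·ᵀ A) →
  μ₁ + (n ∸ 1) * μ₂ ≡ k₁ * k₂ + k₂ * k₁
crossGram-parameters {n} {k₁} {k₂} {μ₁} {μ₂} A B colA colB cross =
  *-cancelˡ-≡ _ _ n (begin
    n * (μ₁ + (n ∸ 1) * μ₂)           ≡⟨ total-IJ {n} μ₁ μ₂ ⟨
    total (IJ {n} μ₁ μ₂)              ≡⟨ total-cong cross ⟨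
    total (A ·ᵀ B ⊞ B ·ᵀ A)           ≡⟨ total-⊞ (A ·ᵀ B) (B ·ᵀ A) ⟩
    total (A ·ᵀ B) + total (B ·ᵀ A)   ≡⟨ cong₂ _+_ (total-·ᵀ-const colA colB) (total-·ᵀ-const colB colA) ⟩
    n * (k₁ * k₂) + n * (k₂ * k₁)     ≡⟨ *-distribˡ-+ n _ _ ⟨
    n * (k₁ * k₂ + k₂ * k₁)           ∎)

crossGram-diagonal : ∀ {n μ₁ μ₂} (A B : Mat n) → IsIJ μ₁ μ₂ (A ·ᵀ B ⊞ B ·ᵀ A) →
  ∀ a → (A ·ᵀ B) a a + (A ·ᵀ B) a a ≡ μ₁
crossGram-diagonal A B cross a =
  trans (cong ((A ·ᵀ B) a a +_) (·ᵀ-comm A B a a)) (trans (cross a a) (IJ-diag a))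

crossGram-zero : ∀ {n} {B : Mat n} → (∀ a c → B a c ≡ 0) → ∀ (X : Mat n) a a' → (X ·ᵀ B ⊞ B ·ᵀ X) a a' ≡ 0
crossGram-zero {B = B} B≡0 X a a' = cong₂ _+_
  (sumF-zero (λ c → trans (cong (X a c *_) (B≡0 a' c)) (*-zeroʳ (X a c))))
  (sumF-zero (λ c → cong (_* X a' c) (B≡0 a c)))

identity-regular : ∀ {n l} → (∀ {a a' : Fin n} → a ≢ a' → l ≡ 0) → IsRegularSymDesign n 1 l identity
identity-regular l≡0 = record
  { binary  = binary
  ; rowSum≡ = sumF-IJ-select (λ _ → 1)
  ; colSum≡ = λ c → trans (sumF-cong (λ a → IJ-sym a c)) (sumF-IJ-select (λ _ → 1) c)
  ; gram    = IsIJ-offDiagonal l≡0 (·ᵀ-identity identity)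
  }
  where
  binary : Binary identity
  binary a c with a ≟ c
  ... | yes _ = inj₂ refl
  ... | no _  = inj₁ refl

identity-pair : ∀ {n l₁ l₂ μ₂} → (∀ {a a' : Fin n} → a ≢ a' → l₁ ≡ 0) →
  (∀ {a a' : Fin n} → a ≢ a' → l₂ ≡ 0) → (∀ {a a' : Fin n} → a ≢ a' → μ₂ ≡ 0) →
  IsRegularPair identity identity 1 1 l₁ l₂ 2 μ₂
identity-pair l₁≡0 l₂≡0 μ₂≡0 = record
  { design₁   = identity-regular l₁≡0
  ; design₂   = identity-regular l₂≡0
  ; crossGram = IsIJ-offDiagonal μ₂≡0 (λ a a' →
      trans (cong₂ _+_ (·ᵀ-identity identity a a') (·ᵀ-identity identity a a')) (IJ-zip _+_ a a'))
  }

binary? : ∀ {n} (A : Mat n) → Dec (Binary A)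
binary? A = all? λ a → all? λ c → (A a c ℕ.≟ 0) ⊎-dec (A a c ℕ.≟ 1)

entrywise? : ∀ {n} (M M' : Mat n) → Dec (∀ a a' → M a a' ≡ M' a a')
entrywise? M M' = all? λ a → all? λ a' → M a a' ℕ.≟ M' a a'

lineSums? : ∀ {n} (f : Fin n → ℕ) k → Dec (∀ a → f a ≡ k)
lineSums? f k = all? λ a → f a ℕ.≟ k

swap₂ : Mat 2
swap₂ = IJ 0 1

swap₂-pair : IsRegularPair identity swap₂ 1 1 0 0 0 2
swap₂-pair = record
  { design₁   = identity-regular λ _ → refl
  ; design₂   = record
    { binary  = from-yes (binary? swap₂)
    ; rowSum≡ = from-yes (lineSums? (rowSum swap₂) 1)
    ; colSum≡ = from-yes (lineSums? (colSum swap₂) 1)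
    ; gram    = from-yes (entrywise? (swap₂ ·ᵀ swap₂) identity)
    }
  ; crossGram = from-yes (entrywise? (identity ·ᵀ swap₂ ⊞ swap₂ ·ᵀ identity) (IJ 0 2))
  }

cycle₃ : Mat 3
cycle₃ 0F 1F = 1
cycle₃ 1F 2F = 1
cycle₃ 2F 0F = 1
cycle₃ _  _  = 0

cycle₃-pair : IsRegularPair identity cycle₃ 1 1 0 0 0 1
cycle₃-pair = record
  { design₁   = identity-regular λ _ → refl
  ; design₂   = record
    { binary  = from-yes (binary? cycle₃)
    ; rowSum≡ = from-yes (lineSums? (rowSum cycle₃) 1)
    ; colSum≡ = from-yes (lineSums? (colSum cycle₃) 1)
    ; gram    = from-yes (entrywise? (cycle₃ ·ᵀ cycle₃) identity)
    }
  ; crossGram = from-yes (entrywise? (identity ·ᵀ cycle₃ ⊞ cycle₃ ·ᵀ identity) (IJ 0 1))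
  }

RegularPair : ℕ → (k₁ k₂ l₁ l₂ μ₁ μ₂ : ℕ) → Set
RegularPair n k₁ k₂ l₁ l₂ μ₁ μ₂ = Σ (Mat n) λ A → Σ (Mat n) λ B → IsRegularPair A B k₁ k₂ l₁ l₂ μ₁ μ₂

RegularPair-cast : ∀ {n k₁ k₂ l₁ l₂ l₁' l₂' μ₁ μ₂} → l₁ ≡ l₁' → l₂ ≡ l₂' →
  RegularPair n k₁ k₂ l₁' l₂' μ₁ μ₂ → RegularPair n k₁ k₂ l₁ l₂ μ₁ μ₂
RegularPair-cast refl refl P = P

RegularPair-swap : ∀ {n k₁ k₂ l₁ l₂ μ₁ μ₂} → RegularPair n k₁ k₂ l₁ l₂ μ₁ μ₂ → RegularPair n k₂ k₁ l₂ l₁ μ₁ μ₂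
RegularPair-swap (A , B , P) =
  B , A , record { design₁ = design₂ ; design₂ = design₁ ; crossGram = IsIJ-⊞-comm {M = A ·ᵀ B} crossGram }
  where open IsRegularPair P

RegularPair-empty : ∀ {k₁ k₂ l₁ l₂ μ₁ μ₂} → RegularPair 0 k₁ k₂ l₁ l₂ μ₁ μ₂
RegularPair-empty = identity , identity , record
  { design₁ = empty ; design₂ = empty ; crossGram = λ () }
  where
  empty : ∀ {k l} → IsRegularSymDesign 0 k l identity
  empty = record { binary = λ () ; rowSum≡ = λ () ; colSum≡ = λ () ; gram = λ () }

rowSum≡-of-partner : ∀ {n k₁ k l₁ l₂ μ₁ μ₂} {A B : Mat n} → IsSymDesign n k₁ l₁ A →
  IsRegularSymDesign n (suc k) l₂ B → IsIJ μ₁ μ₂ (A ·ᵀ B ⊞ B ·ᵀ A) → ∀ a → rowSum A a ≡ k₁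
rowSum≡-of-partner {n} {k₁} {k} {μ₁ = μ₁} {μ₂} {A} {B} (_ , colA , _) DB cross =
  rowSum-const A colA λ a b → +-cancelʳ-≡ (suc k * k₁) _ _ (trans (shifted a) (sym (shifted b)))
  where
  open IsRegularSymDesign DB
  shifted : ∀ a → rowSum A a * suc k + suc k * k₁ ≡ μ₁ + (n ∸ 1) * μ₂
  shifted a = trans (cong (λ r → rowSum A a * suc k + r * k₁) (sym (rowSum≡ a)))
                    (crossGram-rowSum colA colSum≡ cross a)

regularPair-1 : ∀ {n k l₁ l₂ μ₁ μ₂} {A B : Mat n} → IsSymDesign n 1 l₁ A → IsSymDesign n k l₂ B →
  k ≢ 1 → IsIJ μ₁ μ₂ (A ·ᵀ B ⊞ B ·ᵀ A) → RegularPair n 1 k l₁ l₂ μ₁ μ₂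
regularPair-1 {k = zero} {A = A} {B} D₁ D₂ _ cross = identity , B , record
  { design₁   = identity-regular (l≡0-of-k≡1 D₁)
  ; design₂   = regular-of-rowSums D₂ (rowSum≡-of-≢1 D₂ λ ())
  ; crossGram = λ a a' → trans (crossGram-zero B≡0 identity a a')
                           (trans (sym (crossGram-zero B≡0 A a a')) (cross a a'))
  }
  where
  B≡0 = zero-of-k≡0 D₂
regularPair-1 {k = suc zero} _ _ k≢1 _ = contradiction refl k≢1
regularPair-1 {k = suc (suc k)} {A = A} {B} D₁ D₂ _ cross = A , B , record
  { design₁   = regular-of-rowSums D₁ (rowSum≡-of-partner D₁ B-regular cross)
  ; design₂   = B-regular
  ; crossGram = cross
  }
  where
  B-regular = regular-of-rowSums D₂ (rowSum≡-of-≢1 D₂ λ ())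

even+y≡2 : ∀ x y {z} → z ≡ x + x → z + y ≡ 2 → (z ≡ 0 × y ≡ 2) ⊎ (z ≡ 2 × y ≡ 0)
even+y≡2 zero          y refl eq = inj₁ (refl , eq)
even+y≡2 (suc zero)    y refl eq = inj₂ (refl , cong (_∸ 2) eq)
even+y≡2 (suc (suc x)) y refl eq = contradiction (m+n≡0⇒n≡0 x (m+n≡0⇒m≡0 _ (cong (_∸ 2) eq))) λ ()

m*n≡2 : ∀ m n → m * n ≡ 2 → (m ≡ 1 × n ≡ 2) ⊎ (m ≡ 2 × n ≡ 1)
m*n≡2 m       0                   eq = contradiction (trans (sym (*-zeroʳ m)) eq) λ ()
m*n≡2 m       1                   eq = inj₂ (trans (sym (*-identityʳ m)) eq , refl)
m*n≡2 m       2                   eq = inj₁ (*-cancelʳ-≡ m 1 2 eq , refl)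
m*n≡2 zero    (suc (suc (suc n))) ()
m*n≡2 (suc m) (suc (suc (suc n))) ()

-- The rows of the given matrices need not have constant sums here.  Counting
-- gives μ₁ + (n − 1) μ₂ = 2 with μ₁ even, so (μ₁ , μ₂) = (2 , 0), or μ₁ = 0
-- and (n , μ₂) is (2 , 2) or (3 , 1); each case is realised by the identity
-- and a permutation matrix.
regularPair-1-1 : ∀ {n l₁ l₂ μ₁ μ₂} {A B : Mat n} → IsSymDesign n 1 l₁ A → IsSymDesign n 1 l₂ B →
  IsIJ μ₁ μ₂ (A ·ᵀ B ⊞ B ·ᵀ A) → RegularPair n 1 1 l₁ l₂ μ₁ μ₂
regularPair-1-1 {zero} _ _ _ = RegularPair-empty
regularPair-1-1 {suc n} {μ₂ = μ₂} {A} {B} D₁@(_ , colA , _) D₂@(_ , colB , _) cross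
  with even+y≡2 ((A ·ᵀ B) 0F 0F) (n * μ₂) (sym (crossGram-diagonal A B cross 0F))
         (crossGram-parameters A B colA colB cross)
... | inj₂ (refl , nμ₂≡0) =
  identity , identity , identity-pair (l≡0-of-k≡1 D₁) (l≡0-of-k≡1 D₂)
    λ a≢a' → m*n≡0⇒m≡0 μ₂ n {{nonZeroIndex (punchOut a≢a')}} (trans (*-comm μ₂ n) nμ₂≡0)
... | inj₁ (refl , nμ₂≡2) with m*n≡2 n μ₂ nμ₂≡2
...   | inj₁ (refl , refl) =
  RegularPair-cast (l≡0-of-k≡1 D₁ {0F} {1F} λ ()) (l≡0-of-k≡1 D₂ {0F} {1F} λ ())
    (identity , swap₂ , swap₂-pair)
...   | inj₂ (refl , refl) =
  RegularPair-cast (l≡0-of-k≡1 D₁ {0F} {1F} λ ()) (l≡0-of-k≡1 D₂ {0F} {1F} λ ())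
    (identity , cycle₃ , cycle₃-pair)

regularPair : ∀ {n k₁ k₂ l₁ l₂ μ₁ μ₂} {A B : Mat n} → IsSymDesign n k₁ l₁ A → IsSymDesign n k₂ l₂ B →
  IsIJ μ₁ μ₂ (A ·ᵀ B ⊞ B ·ᵀ A) → RegularPair n k₁ k₂ l₁ l₂ μ₁ μ₂
regularPair {k₁ = k₁} {k₂} {A = A} {B} D₁ D₂ cross with k₁ ℕ.≟ 1 | k₂ ℕ.≟ 1
... | yes refl | yes refl = regularPair-1-1 D₁ D₂ cross
... | yes refl | no k₂≢1  = regularPair-1 D₁ D₂ k₂≢1 cross
... | no k₁≢1  | yes refl = RegularPair-swap (regularPair-1 D₂ D₁ k₁≢1 (IsIJ-⊞-comm {M = A ·ᵀ B} cross))
... | no k₁≢1  | no k₂≢1  = A , B , record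
  { design₁   = regular-of-rowSums D₁ (rowSum≡-of-≢1 D₁ k₁≢1)
  ; design₂   = regular-of-rowSums D₂ (rowSum≡-of-≢1 D₂ k₂≢1)
  ; crossGram = cross
  }

theorem4 : (n k₁ k₂ l₁ l₂ μ₁ μ₂ : ℕ) (N₁ N₂ : Mat n) →
    IsSymDesign n k₁ l₁ N₁ →
    IsSymDesign n k₂ l₂ N₂ →
    (∀ a a' → sumF (λ c → N₁ a c * N₂ a' c) + sumF (λ c → N₂ a c * N₁ a' c)
                ≡ IJ μ₁ μ₂ a a') →
    (m : ℕ) → 2 ≤ m →
    Σ (MatR m n) λ N →
      IsSDRD m n (k₁ + (m ∸ 1) * k₂) (k₁ + (m ∸ 1) * k₂)
        (l₁ + (m ∸ 1) * l₂) ((m ∸ 2) * k₂ + μ₁) ((m ∸ 2) * l₂ + μ₂) N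
      × IsSTD N
      × IsGlobalDecomposable m n (k₁ + (m ∸ 1) * k₂)
          (l₁ + (m ∸ 1) * l₂) ((m ∸ 2) * k₂ + μ₁) ((m ∸ 2) * l₂ + μ₂) N
-- the construction works for every m
theorem4 n k₁ k₂ l₁ l₂ μ₁ μ₂ N₁ N₂ D₁ D₂ cross m _ =
  let _ , _ , P = regularPair D₁ D₂ cross in blockDesign P m
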